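{- Let $\mathcal{C}$ be a cd-category with effect conditioning. Then for every morphism $f\colon X\to Y\otimes Z$, $$f=(f|_Z\otimes\mathrm{id}_Z)\circ(\mathrm{id}_X\otimes\Delta_Z)\circ(\mathrm{id}_X\otimes f_Z)\circ\Delta_X,$$ where $f_Z:=(\epsilon_Y\otimes\mathrm{id}_Z)\circ f\colon X\to Z$ is the marginal of $f$ on $Z$ and $f|_Z\colon X\otimes Z\to Y$ is the conditional.
   Context: A cd-category is a symmetric monoidal category $(\mathcal{C},\otimes,I)$ (symmetry $\sigma$) in which every object $X$ carries $\Delta_X\colon X\to X\otimes X$ and $\epsilon_X\colon X\to I$ forming a commutative comonoid, compatible with the tensor ($\Delta_{X\otimes Y}=(\mathrm{id}\otimes\sigma\otimes\mathrm{id})\circ(\Delta_X\otimes\Delta_Y)$, $\epsilon_{X\otimes Y}=\epsilon_X\otimes\epsilon_Y$, $\Delta_I=\epsilon_I=\mathrm{id}_I$). A partial channel is $f\colon X\to Y$ with $f=(f\otimes(\epsilon_Y\circ f))\circ\Delta_X$. Effect conditioning: $\mathcal{C}$ has (i) normalisation: a partial channel $\mathrm{norm}(f)$ for each $f\colon X\to Y$ with $f=(\mathrm{norm}(f)\otimes(\epsilon_Y\circ f))\circ\Delta_X$, $\mathrm{norm}(f)=f$ for partial channels, $\mathrm{norm}(f\otimes g)=\mathrm{norm}(f)\otimes\mathrm{norm}(g)$, $\mathrm{norm}(\epsilon\circ f)=\epsilon\circ\mathrm{norm}(f)$, $\mathrm{norm}(f\circ\Delta_X)=\mathrm{norm}(f)\circ\Delta_X$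 for $f\colon X\otimes X\to Y$; (ii) cancellative caps: effects $\cap_X\colon X\otimes X\to I$ that are symmetric, satisfy $\cap_X\circ\Delta_X=\epsilon_X$, $(\cap_X\otimes\mathrm{id})\circ(\mathrm{id}\otimes\Delta_X)=(\mathrm{id}\otimes\cap_X)\circ(\Delta_X\otimes\mathrm{id})$, are compatible with $\otimes$, and such that $(\mathrm{id}_B\otimes\cap_X)\circ(f\otimes\mathrm{id}_X)=(\mathrm{id}_B\otimes\cap_X)\circ(g\otimes\mathrm{id}_X)$ implies $f=g$ for $f,g\colon A\to B\otimes X$. Conditional: $f|_Z:=\mathrm{norm}((\mathrm{id}_Y\otimes\cap_Z)\circ(f\otimes\mathrm{id}_Z))\colon X\otimes Z\to Y$. -}

module Defs where

open import Level using (Level; _⊔_) renaming (suc to lsuc)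
open import Relation.Binary.PropositionalEquality using (_≡_)

record SymmetricMonoidalCategory (o ℓ : Level) : Set (lsuc (o ⊔ ℓ)) where
  infixr 9 _∘_
  infixr 10 _⊗₀_ _⊗₁_
  field
    Obj : Set o
    Hom : Obj → Obj → Set ℓ
    id  : ∀ {A} → Hom A A
    _∘_ : ∀ {A B C} → Hom B C → Hom A B → Hom A C
    assoc     : ∀ {A B C D} (f : Hom A B) (g : Hom B C) (h : Hom C D) →
                (h ∘ g) ∘ f ≡ h ∘ (g ∘ f)
    identityˡ : ∀ {A B} (f : Hom A B) → id ∘ f ≡ f
    identityʳ : ∀ {A B} (f : Hom A B) → f ∘ id ≡ f

    _⊗₀_ : Obj → Obj → Obj
    _⊗₁_ : ∀ {A B C D} → Hom A B → Hom C D → Hom (A ⊗₀ C) (B ⊗₀ D)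
    ⊗-id : ∀ {A B} → (id {A}) ⊗₁ (id {B}) ≡ id
    ⊗-∘  : ∀ {A B C D E F} (f : Hom B C) (g : Hom A B) (h : Hom E F) (k : Hom D E) →
           (f ∘ g) ⊗₁ (h ∘ k) ≡ (f ⊗₁ h) ∘ (g ⊗₁ k)

    unit : Obj

    α⇒ : ∀ {A B C} → Hom ((A ⊗₀ B) ⊗₀ C) (A ⊗₀ (B ⊗₀ C))
    α⇐ : ∀ {A B C} → Hom (A ⊗₀ (B ⊗₀ C)) ((A ⊗₀ B) ⊗₀ C)
    lu⇒ : ∀ {A} → Hom (unit ⊗₀ A) A
    lu⇐ : ∀ {A} → Hom A (unit ⊗₀ A)
    ru⇒ : ∀ {A} → Hom (A ⊗₀ unit) A
    ru⇐ : ∀ {A} → Hom A (A ⊗₀ unit)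
    σ   : ∀ {A B} → Hom (A ⊗₀ B) (B ⊗₀ A)

    α-isoˡ  : ∀ {A B C} → α⇐ {A} {B} {C} ∘ α⇒ ≡ id
    α-isoʳ  : ∀ {A B C} → α⇒ {A} {B} {C} ∘ α⇐ ≡ id
    lu-isoˡ : ∀ {A} → lu⇐ {A} ∘ lu⇒ ≡ id
    lu-isoʳ : ∀ {A} → lu⇒ {A} ∘ lu⇐ ≡ id
    ru-isoˡ : ∀ {A} → ru⇐ {A} ∘ ru⇒ ≡ id
    ru-isoʳ : ∀ {A} → ru⇒ {A} ∘ ru⇐ ≡ id
    σ-invol : ∀ {A B} → σ {B} {A} ∘ σ {A} {B} ≡ id

    α-natural  : ∀ {A A′ B B′ C C′} (f : Hom A A′) (g : Hom B B′) (h : Hom C C′) →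
                 α⇒ ∘ ((f ⊗₁ g) ⊗₁ h) ≡ (f ⊗₁ (g ⊗₁ h)) ∘ α⇒
    lu-natural : ∀ {A B} (f : Hom A B) → lu⇒ ∘ (id {unit} ⊗₁ f) ≡ f ∘ lu⇒
    ru-natural : ∀ {A B} (f : Hom A B) → ru⇒ ∘ (f ⊗₁ id {unit}) ≡ f ∘ ru⇒
    σ-natural  : ∀ {A A′ B B′} (f : Hom A A′) (g : Hom B B′) →
                 σ ∘ (f ⊗₁ g) ≡ (g ⊗₁ f) ∘ σ

    pentagon : ∀ {W X Y Z} →
               (id {W} ⊗₁ α⇒ {X} {Y} {Z}) ∘ α⇒ {W} {X ⊗₀ Y} {Z} ∘ (α⇒ {W} {X} {Y} ⊗₁ id {Z})
               ≡ α⇒ {W} {X} {Y ⊗₀ Z} ∘ α⇒ {W ⊗₀ X} {Y} {Z}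
    triangle : ∀ {X Y} → (id {X} ⊗₁ lu⇒ {Y}) ∘ α⇒ {X} {unit} {Y} ≡ ru⇒ {X} ⊗₁ id {Y}
    hexagon  : ∀ {X Y Z} →
               α⇒ {Y} {Z} {X} ∘ σ {X} {Y ⊗₀ Z} ∘ α⇒ {X} {Y} {Z}
               ≡ (id {Y} ⊗₁ σ {X} {Z}) ∘ α⇒ {Y} {X} {Z} ∘ (σ {X} {Y} ⊗₁ id {Z})

module SMCNotation {o ℓ : Level} (C : SymmetricMonoidalCategory o ℓ) where
  open SymmetricMonoidalCategory C

  -- the "middle swap" (id ⊗ σ ⊗ id) : (A ⊗ B) ⊗ (C ⊗ D) → (A ⊗ C) ⊗ (B ⊗ D)
  mid-swap : ∀ {A B C′ D} → Hom ((A ⊗₀ B) ⊗₀ (C′ ⊗₀ D)) ((A ⊗₀ C′) ⊗₀ (B ⊗₀ D))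
  mid-swap {A} {B} {C′} {D} =
    α⇐ {A} {C′} {B ⊗₀ D}
    ∘ (id {A} ⊗₁ (α⇒ {C′} {B} {D} ∘ (σ {B} {C′} ⊗₁ id {D}) ∘ α⇐ {B} {C′} {D}))
    ∘ α⇒ {A} {B} {C′ ⊗₀ D}

-- cd-structure: a commutative comonoid on every object, compatible with ⊗.
-- (Copy and discard are NOT required to be natural.)
record CDStructure {o ℓ : Level} (C : SymmetricMonoidalCategory o ℓ) : Set (o ⊔ ℓ) where
  open SymmetricMonoidalCategory C
  open SMCNotation C
  field
    copy    : ∀ X → Hom X (X ⊗₀ X)
    discard : ∀ X → Hom X unit
    copy-coassoc : ∀ X → α⇒ ∘ (copy X ⊗₁ id) ∘ copy X ≡ (id ⊗₁ copy X) ∘ copy X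
    copy-counitˡ : ∀ X → lu⇒ ∘ (discard X ⊗₁ id) ∘ copy X ≡ id
    copy-counitʳ : ∀ X → ru⇒ ∘ (id ⊗₁ discard X) ∘ copy X ≡ id
    copy-comm    : ∀ X → σ ∘ copy X ≡ copy X
    copy-⊗    : ∀ X Y → copy (X ⊗₀ Y) ≡ mid-swap ∘ (copy X ⊗₁ copy Y)
    discard-⊗ : ∀ X Y → discard (X ⊗₀ Y) ≡ lu⇒ ∘ (discard X ⊗₁ discard Y)
    copy-unit    : copy unit ≡ lu⇐
    discard-unit : discard unit ≡ id

module CDNotation {o ℓ : Level} {C : SymmetricMonoidalCategory o ℓ} (D : CDStructure C) where
  open SymmetricMonoidalCategory C
  open CDStructure D

  IsPartialChannel : ∀ {X Y} → Hom X Y → Set ℓ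
  IsPartialChannel {X} {Y} f = f ≡ ru⇒ ∘ (f ⊗₁ (discard Y ∘ f)) ∘ copy X

record EffectConditioning {o ℓ : Level} {C : SymmetricMonoidalCategory o ℓ}
                          (D : CDStructure C) : Set (o ⊔ ℓ) where
  open SymmetricMonoidalCategory C
  open SMCNotation C
  open CDStructure D
  open CDNotation D
  field
    norm : ∀ {X Y} → Hom X Y → Hom X Y
    norm-partial : ∀ {X Y} (f : Hom X Y) → IsPartialChannel (norm f)
    norm-factor  : ∀ {X Y} (f : Hom X Y) →
                   f ≡ ru⇒ ∘ (norm f ⊗₁ (discard Y ∘ f)) ∘ copy X
    norm-fixes   : ∀ {X Y} (f : Hom X Y) → IsPartialChannel f → norm f ≡ f
    norm-⊗       : ∀ {A B C′ D′} (f : Hom A B) (g : Hom C′ D′) →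
                   norm (f ⊗₁ g) ≡ norm f ⊗₁ norm g
    norm-discard : ∀ {X Y} (f : Hom X Y) → norm (discard Y ∘ f) ≡ discard Y ∘ norm f
    norm-copy    : ∀ {X Y} (f : Hom (X ⊗₀ X) Y) → norm (f ∘ copy X) ≡ norm f ∘ copy X
    cap : ∀ X → Hom (X ⊗₀ X) unit
    cap-sym   : ∀ X → cap X ∘ σ ≡ cap X
    cap-copy  : ∀ X → cap X ∘ copy X ≡ discard X
    cap-slide : ∀ X → lu⇒ ∘ (cap X ⊗₁ id) ∘ α⇐ ∘ (id ⊗₁ copy X)
                      ≡ ru⇒ ∘ (id ⊗₁ cap X) ∘ α⇒ ∘ (copy X ⊗₁ id)
    cap-⊗     : ∀ X Y → cap (X ⊗₀ Y) ≡ lu⇒ ∘ (cap X ⊗₁ cap Y) ∘ mid-swap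
    cap-cancel : ∀ {A B X} (f g : Hom A (B ⊗₀ X)) →
                 ru⇒ ∘ (id {B} ⊗₁ cap X) ∘ α⇒ ∘ (f ⊗₁ id {X})
                 ≡ ru⇒ ∘ (id {B} ⊗₁ cap X) ∘ α⇒ ∘ (g ⊗₁ id {X}) →
                 f ≡ g

module ECNotation {o ℓ : Level} {C : SymmetricMonoidalCategory o ℓ} {D : CDStructure C}
                  (E : EffectConditioning D) where
  open SymmetricMonoidalCategory C
  open CDStructure D
  open EffectConditioning E

  marginal : ∀ {X Y Z} → Hom X (Y ⊗₀ Z) → Hom X Z
  marginal {Y = Y} f = lu⇒ ∘ (discard Y ⊗₁ id) ∘ f

  conditional : ∀ {X Y Z} → Hom X (Y ⊗₀ Z) → Hom (X ⊗₀ Z) Y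
  conditional {Y = Y} {Z = Z} f =
    norm (ru⇒ ∘ (id {Y} ⊗₁ cap Z) ∘ α⇒ ∘ (f ⊗₁ id {Z}))

{-# OPTIONS --safe #-}
-- Write ⌈f⌉ := (id ⊗ ∩_Z) ∘ (f ⊗ id), so that f|_Z = norm ⌈f⌉, and for an effect e let
-- weight e := (id ⊗ e) ∘ Δ.  Normalisation factors ⌈f⌉ as f|_Z ∘ weight (ε ∘ ⌈f⌉), and
-- ε ∘ ⌈f⌉ = ∩_Z ∘ (f_Z ⊗ id) depends only on the marginal.  Sliding the cap along the copy
-- of Z turns weighting by ∩_Z ∘ (f_Z ⊗ id) into ⌈g⌉ for g = (id ⊗ Δ_Z)(id ⊗ f_Z)Δ_X.
-- Hence ⌈f⌉ = f|_Z ∘ ⌈g⌉ = ⌈(f|_Z ⊗ id) ∘ g⌉, and cancellativity of caps removes ⌈-⌉.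
module Submission where

open import Defs
open import Level using (Level)
open import Relation.Binary.PropositionalEquality using (_≡_; sym; trans; cong; cong₂)
import Relation.Binary.PropositionalEquality as Eq

module SMCProperties {o ℓ : Level} (C : SymmetricMonoidalCategory o ℓ) where
  open SymmetricMonoidalCategory C
  open Eq.≡-Reasoning

  infixr 4 refl⟩∘⟨_
  infixl 4 _⟩∘⟨refl

  refl⟩∘⟨_ : ∀ {A B P} {f g : Hom A B} {h : Hom B P} → f ≡ g → h ∘ f ≡ h ∘ g
  refl⟩∘⟨_ {h = h} = cong (h ∘_)

  _⟩∘⟨refl : ∀ {A B P} {f g : Hom B P} {h : Hom A B} → f ≡ g → f ∘ h ≡ g ∘ h
  _⟩∘⟨refl {h = h} = cong (_∘ h)

  pullˡ : ∀ {A B P Q} {a : Hom A B} {b : Hom B P} {h : Hom A P} {k : Hom Q A} →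
          b ∘ a ≡ h → b ∘ a ∘ k ≡ h ∘ k
  pullˡ {a = a} {b} {k = k} p = trans (sym (assoc k a b)) (p ⟩∘⟨refl)

  pull₃ˡ : ∀ {A B P Q R} {a : Hom P Q} {b : Hom B P} {d : Hom A B} {h : Hom A Q} {r : Hom R A} →
           a ∘ b ∘ d ≡ h → a ∘ b ∘ d ∘ r ≡ h ∘ r
  pull₃ˡ p = trans (refl⟩∘⟨ sym (assoc _ _ _)) (pullˡ p)

  pull₄ˡ : ∀ {A B P Q R S} {a : Hom Q S} {b : Hom P Q} {d : Hom B P} {e : Hom A B}
             {h : Hom A S} {r : Hom R A} →
           a ∘ b ∘ d ∘ e ≡ h → a ∘ b ∘ d ∘ e ∘ r ≡ h ∘ r
  pull₄ˡ p = trans (refl⟩∘⟨ refl⟩∘⟨ sym (assoc _ _ _)) (pull₃ˡ p)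

  extendˡ : ∀ {A B B′ P Q} {a : Hom A B} {b : Hom B P} {c : Hom A B′} {d : Hom B′ P} {k : Hom Q A} →
            b ∘ a ≡ d ∘ c → b ∘ a ∘ k ≡ d ∘ c ∘ k
  extendˡ {a = a} {b} {c} {d} {k} p = trans (sym (assoc k a b)) (trans (p ⟩∘⟨refl) (assoc k c d))

  assoc₃ : ∀ {A B P Q R} {a : Hom P Q} {b : Hom B P} {d : Hom A B} {r : Hom R A} →
           (a ∘ b ∘ d) ∘ r ≡ a ∘ b ∘ d ∘ r
  assoc₃ = trans (assoc _ _ _) (refl⟩∘⟨ assoc _ _ _)

  split-epi-cancel : ∀ {A B P} {f g : Hom B P} {i : Hom A B} {j : Hom B A} →
                     i ∘ j ≡ id → f ∘ i ≡ g ∘ i → f ≡ g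
  split-epi-cancel {f = f} {g} {i} {j} ij p = begin
    f
      ≡⟨ sym (identityʳ f) ⟩
    f ∘ id
      ≡⟨ refl⟩∘⟨ sym ij ⟩
    f ∘ i ∘ j
      ≡⟨ pullˡ p ⟩
    (g ∘ i) ∘ j
      ≡⟨ assoc j i g ⟩
    g ∘ i ∘ j
      ≡⟨ refl⟩∘⟨ ij ⟩
    g ∘ id
      ≡⟨ identityʳ g ⟩
    g ∎

  split-mono-cancel : ∀ {A B P} {f g : Hom P A} {i : Hom A B} {j : Hom B A} →
                      j ∘ i ≡ id → i ∘ f ≡ i ∘ g → f ≡ g
  split-mono-cancel {f = f} {g} {i} {j} ji p = begin
    f
      ≡⟨ sym (identityˡ f) ⟩
    id ∘ f
      ≡⟨ sym ji ⟩∘⟨refl ⟩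
    (j ∘ i) ∘ f
      ≡⟨ assoc f i j ⟩
    j ∘ i ∘ f
      ≡⟨ refl⟩∘⟨ p ⟩
    j ∘ i ∘ g
      ≡⟨ sym (assoc g i j) ⟩
    (j ∘ i) ∘ g
      ≡⟨ ji ⟩∘⟨refl ⟩
    id ∘ g
      ≡⟨ identityˡ g ⟩
    g ∎

  ⊗id-distrib : ∀ {A B P Q} {f : Hom B P} {g : Hom A B} → (f ∘ g) ⊗₁ id {Q} ≡ (f ⊗₁ id) ∘ (g ⊗₁ id)
  ⊗id-distrib {f = f} {g} = trans (cong ((f ∘ g) ⊗₁_) (sym (identityˡ id))) (⊗-∘ f g id id)

  id⊗-distrib : ∀ {A B P Q} {f : Hom B P} {g : Hom A B} → id {Q} ⊗₁ (f ∘ g) ≡ (id ⊗₁ f) ∘ (id ⊗₁ g)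
  id⊗-distrib {f = f} {g} = trans (cong (_⊗₁ (f ∘ g)) (sym (identityˡ id))) (⊗-∘ id id f g)

  serialize₁₂ : ∀ {A B P Q} {f : Hom A B} {g : Hom P Q} → f ⊗₁ g ≡ (f ⊗₁ id) ∘ (id ⊗₁ g)
  serialize₁₂ {f = f} {g} = trans (cong₂ _⊗₁_ (sym (identityʳ f)) (sym (identityˡ g))) (⊗-∘ f id id g)

  serialize₂₁ : ∀ {A B P Q} {f : Hom A B} {g : Hom P Q} → f ⊗₁ g ≡ (id ⊗₁ g) ∘ (f ⊗₁ id)
  serialize₂₁ {f = f} {g} = trans (cong₂ _⊗₁_ (sym (identityˡ f)) (sym (identityʳ g))) (⊗-∘ id f g id)

  ⊗id-commutes-id⊗ : ∀ {A B P Q} {f : Hom A B} {g : Hom P Q} →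
                     (f ⊗₁ id) ∘ (id ⊗₁ g) ≡ (id ⊗₁ g) ∘ (f ⊗₁ id)
  ⊗id-commutes-id⊗ = trans (sym serialize₁₂) serialize₂₁

  ⊗-inverse : ∀ {A B P Q} {a : Hom B A} {b : Hom A B} {c : Hom Q P} {d : Hom P Q} →
              a ∘ b ≡ id → c ∘ d ≡ id → (a ⊗₁ c) ∘ (b ⊗₁ d) ≡ id
  ⊗-inverse {a = a} {b} {c} {d} p q = trans (sym (⊗-∘ a b c d)) (trans (cong₂ _⊗₁_ p q) ⊗-id)

  id⊗-injective : ∀ {A B} {f g : Hom A B} → id {unit} ⊗₁ f ≡ id ⊗₁ g → f ≡ g
  id⊗-injective {f = f} {g} p =
    split-epi-cancel lu-isoʳ (trans (sym (lu-natural f)) (trans (refl⟩∘⟨ p) (lu-natural g)))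

  ⊗id-injective : ∀ {A B} {f g : Hom A B} → f ⊗₁ id {unit} ≡ g ⊗₁ id → f ≡ g
  ⊗id-injective {f = f} {g} p =
    split-epi-cancel ru-isoʳ (trans (sym (ru-natural f)) (trans (refl⟩∘⟨ p) (ru-natural g)))

  α⇐-natural : ∀ {A A′ B B′ P P′} (f : Hom A A′) (g : Hom B B′) (h : Hom P P′) →
               α⇐ ∘ (f ⊗₁ (g ⊗₁ h)) ≡ ((f ⊗₁ g) ⊗₁ h) ∘ α⇐
  α⇐-natural f g h = split-mono-cancel α-isoˡ (begin
    α⇒ ∘ α⇐ ∘ (f ⊗₁ (g ⊗₁ h))
      ≡⟨ pullˡ α-isoʳ ⟩
    id ∘ (f ⊗₁ (g ⊗₁ h))
      ≡⟨ identityˡ _ ⟩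
    f ⊗₁ (g ⊗₁ h)
      ≡⟨ sym (identityʳ _) ⟩
    (f ⊗₁ (g ⊗₁ h)) ∘ id
      ≡⟨ refl⟩∘⟨ sym α-isoʳ ⟩
    (f ⊗₁ (g ⊗₁ h)) ∘ α⇒ ∘ α⇐
      ≡⟨ extendˡ (sym (α-natural f g h)) ⟩
    α⇒ ∘ ((f ⊗₁ g) ⊗₁ h) ∘ α⇐ ∎)

  -- Kelly's coherence lemmas, derived from the pentagon and triangle axioms.
  lu⇒∘α⇒≡lu⇒⊗id : ∀ {A B} → lu⇒ {A ⊗₀ B} ∘ α⇒ {unit} {A} {B} ≡ lu⇒ {A} ⊗₁ id {B}
  lu⇒∘α⇒≡lu⇒⊗id {A} {B} =
    id⊗-injective (split-epi-cancel {i = α⇒ {unit} {unit ⊗₀ A} {B} ∘ (α⇒ {unit} {unit} {A} ⊗₁ id {B})}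
                                    {j = (α⇐ ⊗₁ id) ∘ α⇐} inverse chain)
    where
    inverse : (α⇒ {unit} {unit ⊗₀ A} {B} ∘ (α⇒ {unit} {unit} {A} ⊗₁ id {B})) ∘ ((α⇐ ⊗₁ id) ∘ α⇐) ≡ id
    inverse = begin
      (α⇒ ∘ (α⇒ ⊗₁ id)) ∘ ((α⇐ ⊗₁ id) ∘ α⇐)
        ≡⟨ assoc _ _ _ ⟩
      α⇒ ∘ (α⇒ ⊗₁ id) ∘ (α⇐ ⊗₁ id) ∘ α⇐
        ≡⟨ refl⟩∘⟨ pullˡ (⊗-inverse α-isoʳ (identityˡ id)) ⟩
      α⇒ ∘ id ∘ α⇐
        ≡⟨ refl⟩∘⟨ identityˡ _ ⟩
      α⇒ ∘ α⇐
        ≡⟨ α-isoʳ ⟩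
      id ∎
    chain : (id ⊗₁ (lu⇒ ∘ α⇒)) ∘ α⇒ ∘ (α⇒ ⊗₁ id) ≡ (id ⊗₁ (lu⇒ ⊗₁ id)) ∘ α⇒ ∘ (α⇒ ⊗₁ id)
    chain = begin
      (id ⊗₁ (lu⇒ ∘ α⇒)) ∘ α⇒ ∘ (α⇒ ⊗₁ id)
        ≡⟨ id⊗-distrib ⟩∘⟨refl ⟩
      ((id ⊗₁ lu⇒) ∘ (id ⊗₁ α⇒)) ∘ α⇒ ∘ (α⇒ ⊗₁ id)
        ≡⟨ assoc _ _ _ ⟩
      (id ⊗₁ lu⇒) ∘ (id ⊗₁ α⇒) ∘ α⇒ ∘ (α⇒ ⊗₁ id)
        ≡⟨ refl⟩∘⟨ pentagon ⟩
      (id ⊗₁ lu⇒) ∘ α⇒ ∘ α⇒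
        ≡⟨ pullˡ triangle ⟩
      (ru⇒ ⊗₁ id) ∘ α⇒
        ≡⟨ cong (λ z → (ru⇒ ⊗₁ z) ∘ α⇒) (sym ⊗-id) ⟩
      (ru⇒ ⊗₁ (id ⊗₁ id)) ∘ α⇒
        ≡⟨ sym (α-natural ru⇒ id id) ⟩
      α⇒ ∘ ((ru⇒ ⊗₁ id) ⊗₁ id)
        ≡⟨ refl⟩∘⟨ cong (_⊗₁ id) (sym triangle) ⟩
      α⇒ ∘ (((id ⊗₁ lu⇒) ∘ α⇒) ⊗₁ id)
        ≡⟨ refl⟩∘⟨ ⊗id-distrib ⟩
      α⇒ ∘ ((id ⊗₁ lu⇒) ⊗₁ id) ∘ (α⇒ ⊗₁ id)
        ≡⟨ extendˡ (α-natural id lu⇒ id) ⟩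
      (id ⊗₁ (lu⇒ ⊗₁ id)) ∘ α⇒ ∘ (α⇒ ⊗₁ id) ∎

  ru⇒≡id⊗ru⇒∘α⇒ : ∀ {A B} → ru⇒ {A ⊗₀ B} ≡ (id ⊗₁ ru⇒) ∘ α⇒ {A} {B} {unit}
  ru⇒≡id⊗ru⇒∘α⇒ {A} {B} = ⊗id-injective (split-mono-cancel {i = α⇒ {A} {B} {unit}} α-isoˡ (begin
    α⇒ ∘ (ru⇒ ⊗₁ id)
      ≡⟨ refl⟩∘⟨ sym triangle ⟩
    α⇒ ∘ (id ⊗₁ lu⇒) ∘ α⇒
      ≡⟨ refl⟩∘⟨ (cong (_⊗₁ lu⇒) (sym ⊗-id) ⟩∘⟨refl) ⟩
    α⇒ ∘ ((id ⊗₁ id) ⊗₁ lu⇒) ∘ α⇒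
      ≡⟨ extendˡ (α-natural id id lu⇒) ⟩
    (id ⊗₁ (id ⊗₁ lu⇒)) ∘ α⇒ ∘ α⇒
      ≡⟨ refl⟩∘⟨ sym pentagon ⟩
    (id ⊗₁ (id ⊗₁ lu⇒)) ∘ (id ⊗₁ α⇒) ∘ α⇒ ∘ (α⇒ ⊗₁ id)
      ≡⟨ pullˡ (sym id⊗-distrib) ⟩
    (id ⊗₁ ((id ⊗₁ lu⇒) ∘ α⇒)) ∘ α⇒ ∘ (α⇒ ⊗₁ id)
      ≡⟨ cong (id ⊗₁_) triangle ⟩∘⟨refl ⟩
    (id ⊗₁ (ru⇒ ⊗₁ id)) ∘ α⇒ ∘ (α⇒ ⊗₁ id)
      ≡⟨ extendˡ (sym (α-natural id ru⇒ id)) ⟩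
    α⇒ ∘ ((id ⊗₁ ru⇒) ⊗₁ id) ∘ (α⇒ ⊗₁ id)
      ≡⟨ refl⟩∘⟨ sym ⊗id-distrib ⟩
    α⇒ ∘ (((id ⊗₁ ru⇒) ∘ α⇒) ⊗₁ id) ∎))

  ru⇒∘α⇐≡id⊗ru⇒ : ∀ {A B} → ru⇒ {A ⊗₀ B} ∘ α⇐ ≡ id ⊗₁ ru⇒
  ru⇒∘α⇐≡id⊗ru⇒ = begin
    ru⇒ ∘ α⇐
      ≡⟨ ru⇒≡id⊗ru⇒∘α⇒ ⟩∘⟨refl ⟩
    ((id ⊗₁ ru⇒) ∘ α⇒) ∘ α⇐
      ≡⟨ assoc _ _ _ ⟩
    (id ⊗₁ ru⇒) ∘ α⇒ ∘ α⇐
      ≡⟨ refl⟩∘⟨ α-isoʳ ⟩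
    (id ⊗₁ ru⇒) ∘ id
      ≡⟨ identityʳ _ ⟩
    id ⊗₁ ru⇒ ∎

  lu⇒≡ru⇒ : lu⇒ {unit} ≡ ru⇒ {unit}
  lu⇒≡ru⇒ = ⊗id-injective (trans (sym lu⇒∘α⇒≡lu⇒⊗id) (trans (lu⇒-unit⊗unit ⟩∘⟨refl) triangle))
    where
    lu⇒-unit⊗unit : lu⇒ {unit ⊗₀ unit} ≡ id ⊗₁ lu⇒ {unit}
    lu⇒-unit⊗unit = split-mono-cancel {i = lu⇒ {unit}} lu-isoˡ (sym (lu-natural lu⇒))

  lu⇒∘σ≡ru⇒ : ∀ {A} → lu⇒ {A} ∘ σ {A} {unit} ≡ ru⇒ {A}
  lu⇒∘σ≡ru⇒ {A} = ⊗id-injective (split-mono-cancel {i = σ {A} {unit}} σ-invol (sym (begin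
    σ ∘ (ru⇒ ⊗₁ id)
      ≡⟨ refl⟩∘⟨ sym triangle ⟩
    σ ∘ (id ⊗₁ lu⇒) ∘ α⇒
      ≡⟨ extendˡ (σ-natural id lu⇒) ⟩
    (lu⇒ ⊗₁ id) ∘ σ ∘ α⇒
      ≡⟨ sym lu⇒∘α⇒≡lu⇒⊗id ⟩∘⟨refl ⟩
    (lu⇒ ∘ α⇒) ∘ σ ∘ α⇒
      ≡⟨ assoc _ _ _ ⟩
    lu⇒ ∘ α⇒ ∘ σ ∘ α⇒
      ≡⟨ refl⟩∘⟨ hexagon ⟩
    lu⇒ ∘ (id ⊗₁ σ) ∘ α⇒ ∘ (σ ⊗₁ id)
      ≡⟨ pullˡ (lu-natural σ) ⟩
    (σ ∘ lu⇒) ∘ α⇒ ∘ (σ ⊗₁ id)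
      ≡⟨ assoc _ _ _ ⟩
    σ ∘ lu⇒ ∘ α⇒ ∘ (σ ⊗₁ id)
      ≡⟨ refl⟩∘⟨ pullˡ lu⇒∘α⇒≡lu⇒⊗id ⟩
    σ ∘ (lu⇒ ⊗₁ id) ∘ (σ ⊗₁ id)
      ≡⟨ refl⟩∘⟨ sym ⊗id-distrib ⟩
    σ ∘ ((lu⇒ ∘ σ) ⊗₁ id) ∎)))

  ru⇒∘σ≡lu⇒ : ∀ {A} → ru⇒ {A} ∘ σ {unit} {A} ≡ lu⇒ {A}
  ru⇒∘σ≡lu⇒ = begin
    ru⇒ ∘ σ
      ≡⟨ sym lu⇒∘σ≡ru⇒ ⟩∘⟨refl ⟩
    (lu⇒ ∘ σ) ∘ σ
      ≡⟨ assoc _ _ _ ⟩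
    lu⇒ ∘ σ ∘ σ
      ≡⟨ refl⟩∘⟨ σ-invol ⟩
    lu⇒ ∘ id
      ≡⟨ identityʳ _ ⟩
    lu⇒ ∎

  σ∘α⇒≡hexagon : ∀ {B X A} → σ {B} {X ⊗₀ A} ∘ α⇒ {B} {X} {A} ≡ α⇐ ∘ (id ⊗₁ σ) ∘ α⇒ ∘ (σ ⊗₁ id)
  σ∘α⇒≡hexagon = split-mono-cancel {i = α⇒} α-isoˡ
    (trans hexagon (sym (trans (sym (assoc _ _ _)) (trans (α-isoʳ ⟩∘⟨refl) (identityˡ _)))))

  α⇒∘σ⊗id∘α⇐∘id⊗σ≡σ∘α⇐ : ∀ {X A B} → (α⇒ ∘ (σ ⊗₁ id) ∘ α⇐) ∘ (id ⊗₁ σ) ≡ σ {X ⊗₀ A} {B} ∘ α⇐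
  α⇒∘σ⊗id∘α⇐∘id⊗σ≡σ∘α⇐ {X} {A} {B} = split-mono-cancel {i = σ {B} {X ⊗₀ A}} σ-invol (begin
    σ ∘ (α⇒ ∘ (σ ⊗₁ id) ∘ α⇐) ∘ (id ⊗₁ σ)
      ≡⟨ refl⟩∘⟨ assoc₃ ⟩
    σ ∘ α⇒ ∘ (σ ⊗₁ id) ∘ α⇐ ∘ (id ⊗₁ σ)
      ≡⟨ pullˡ σ∘α⇒≡hexagon ⟩
    (α⇐ ∘ (id ⊗₁ σ) ∘ α⇒ ∘ (σ ⊗₁ id)) ∘ (σ ⊗₁ id) ∘ α⇐ ∘ (id ⊗₁ σ)
      ≡⟨ trans (assoc _ _ _) (refl⟩∘⟨ assoc₃) ⟩
    α⇐ ∘ (id ⊗₁ σ) ∘ α⇒ ∘ (σ ⊗₁ id) ∘ (σ ⊗₁ id) ∘ α⇐ ∘ (id ⊗₁ σ)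
      ≡⟨ refl⟩∘⟨ refl⟩∘⟨ refl⟩∘⟨ trans (pullˡ (⊗-inverse σ-invol (identityˡ id))) (identityˡ _) ⟩
    α⇐ ∘ (id ⊗₁ σ) ∘ α⇒ ∘ α⇐ ∘ (id ⊗₁ σ)
      ≡⟨ refl⟩∘⟨ refl⟩∘⟨ trans (pullˡ α-isoʳ) (identityˡ _) ⟩
    α⇐ ∘ (id ⊗₁ σ) ∘ (id ⊗₁ σ)
      ≡⟨ refl⟩∘⟨ ⊗-inverse (identityˡ id) σ-invol ⟩
    α⇐ ∘ id
      ≡⟨ identityʳ _ ⟩
    α⇐
      ≡⟨ sym (identityˡ _) ⟩
    id ∘ α⇐
      ≡⟨ sym σ-invol ⟩∘⟨refl ⟩
    (σ ∘ σ) ∘ α⇐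
      ≡⟨ assoc _ _ _ ⟩
    σ ∘ σ ∘ α⇐ ∎)

  -- ⌈f⌉ of the proof idea, with an arbitrary effect c in place of the cap.
  contract : ∀ {A B Z W} → Hom (Z ⊗₀ W) unit → Hom A (B ⊗₀ Z) → Hom (A ⊗₀ W) B
  contract {B = B} {W = W} c f = ru⇒ ∘ (id {B} ⊗₁ c) ∘ α⇒ ∘ (f ⊗₁ id {W})

  contract-⊗id∘ : ∀ {A B B′ Z W} (c : Hom (Z ⊗₀ W) unit) (k : Hom B B′) (u : Hom A (B ⊗₀ Z)) →
                  contract c ((k ⊗₁ id) ∘ u) ≡ k ∘ contract c u
  contract-⊗id∘ c k u = begin
    ru⇒ ∘ (id ⊗₁ c) ∘ α⇒ ∘ (((k ⊗₁ id) ∘ u) ⊗₁ id)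
      ≡⟨ refl⟩∘⟨ refl⟩∘⟨ refl⟩∘⟨ ⊗id-distrib ⟩
    ru⇒ ∘ (id ⊗₁ c) ∘ α⇒ ∘ ((k ⊗₁ id) ⊗₁ id) ∘ (u ⊗₁ id)
      ≡⟨ refl⟩∘⟨ refl⟩∘⟨ extendˡ (α-natural k id id) ⟩
    ru⇒ ∘ (id ⊗₁ c) ∘ (k ⊗₁ (id ⊗₁ id)) ∘ α⇒ ∘ (u ⊗₁ id)
      ≡⟨ refl⟩∘⟨ refl⟩∘⟨ (cong (k ⊗₁_) ⊗-id ⟩∘⟨refl) ⟩
    ru⇒ ∘ (id ⊗₁ c) ∘ (k ⊗₁ id) ∘ α⇒ ∘ (u ⊗₁ id)
      ≡⟨ refl⟩∘⟨ extendˡ (sym ⊗id-commutes-id⊗) ⟩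
    ru⇒ ∘ (k ⊗₁ id) ∘ (id ⊗₁ c) ∘ α⇒ ∘ (u ⊗₁ id)
      ≡⟨ pullˡ (ru-natural k) ⟩
    (k ∘ ru⇒) ∘ (id ⊗₁ c) ∘ α⇒ ∘ (u ⊗₁ id)
      ≡⟨ assoc _ _ _ ⟩
    k ∘ ru⇒ ∘ (id ⊗₁ c) ∘ α⇒ ∘ (u ⊗₁ id) ∎

  contract-α⇐ : ∀ {A B P X Z W} (c : Hom (Z ⊗₀ W) unit) (n : Hom X (B ⊗₀ Z)) (h : Hom A (P ⊗₀ X)) →
                contract c (α⇐ ∘ (id ⊗₁ n) ∘ h) ≡ (id ⊗₁ contract c n) ∘ α⇒ ∘ (h ⊗₁ id)
  contract-α⇐ {B = B} {P} {Z = Z} {W} c n h = begin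
    ru⇒ ∘ (id ⊗₁ c) ∘ α⇒ ∘ ((α⇐ ∘ (id ⊗₁ n) ∘ h) ⊗₁ id)
      ≡⟨ refl⟩∘⟨ refl⟩∘⟨ refl⟩∘⟨ trans ⊗id-distrib (refl⟩∘⟨ ⊗id-distrib) ⟩
    ru⇒ ∘ (id ⊗₁ c) ∘ α⇒ ∘ (α⇐ ⊗₁ id) ∘ ((id ⊗₁ n) ⊗₁ id) ∘ (h ⊗₁ id)
      ≡⟨ pull₄ˡ reassociate ⟩
    ((id ⊗₁ bend) ∘ α⇒) ∘ ((id ⊗₁ n) ⊗₁ id) ∘ (h ⊗₁ id)
      ≡⟨ assoc _ _ _ ⟩
    (id ⊗₁ bend) ∘ α⇒ ∘ ((id ⊗₁ n) ⊗₁ id) ∘ (h ⊗₁ id)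
      ≡⟨ refl⟩∘⟨ extendˡ (α-natural id n id) ⟩
    (id ⊗₁ bend) ∘ (id ⊗₁ (n ⊗₁ id)) ∘ α⇒ ∘ (h ⊗₁ id)
      ≡⟨ pullˡ (trans (sym id⊗-distrib) (cong (id ⊗₁_) assoc₃)) ⟩
    (id ⊗₁ contract c n) ∘ α⇒ ∘ (h ⊗₁ id) ∎
    where
    bend : Hom ((B ⊗₀ Z) ⊗₀ W) B
    bend = ru⇒ ∘ (id ⊗₁ c) ∘ α⇒
    reassociate : ru⇒ ∘ (id ⊗₁ c) ∘ α⇒ ∘ (α⇐ ⊗₁ id) ≡ (id {P} ⊗₁ bend) ∘ α⇒
    reassociate = begin
      ru⇒ ∘ (id ⊗₁ c) ∘ α⇒ ∘ (α⇐ ⊗₁ id)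
        ≡⟨ ru⇒≡id⊗ru⇒∘α⇒ ⟩∘⟨refl ⟩
      ((id ⊗₁ ru⇒) ∘ α⇒) ∘ (id ⊗₁ c) ∘ α⇒ ∘ (α⇐ ⊗₁ id)
        ≡⟨ assoc _ _ _ ⟩
      (id ⊗₁ ru⇒) ∘ α⇒ ∘ (id ⊗₁ c) ∘ α⇒ ∘ (α⇐ ⊗₁ id)
        ≡⟨ refl⟩∘⟨ refl⟩∘⟨ (cong (_⊗₁ c) (sym ⊗-id) ⟩∘⟨refl) ⟩
      (id ⊗₁ ru⇒) ∘ α⇒ ∘ ((id ⊗₁ id) ⊗₁ c) ∘ α⇒ ∘ (α⇐ ⊗₁ id)
        ≡⟨ refl⟩∘⟨ extendˡ (α-natural id id c) ⟩
      (id ⊗₁ ru⇒) ∘ (id ⊗₁ (id ⊗₁ c)) ∘ α⇒ ∘ α⇒ ∘ (α⇐ ⊗₁ id)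
        ≡⟨ refl⟩∘⟨ refl⟩∘⟨ pullˡ (sym pentagon) ⟩
      (id ⊗₁ ru⇒) ∘ (id ⊗₁ (id ⊗₁ c)) ∘ ((id ⊗₁ α⇒) ∘ α⇒ ∘ (α⇒ ⊗₁ id)) ∘ (α⇐ ⊗₁ id)
        ≡⟨ refl⟩∘⟨ refl⟩∘⟨ assoc₃ ⟩
      (id ⊗₁ ru⇒) ∘ (id ⊗₁ (id ⊗₁ c)) ∘ (id ⊗₁ α⇒) ∘ α⇒ ∘ (α⇒ ⊗₁ id) ∘ (α⇐ ⊗₁ id)
        ≡⟨ refl⟩∘⟨ refl⟩∘⟨ refl⟩∘⟨ refl⟩∘⟨ ⊗-inverse α-isoʳ (identityˡ id) ⟩
      (id ⊗₁ ru⇒) ∘ (id ⊗₁ (id ⊗₁ c)) ∘ (id ⊗₁ α⇒) ∘ α⇒ ∘ id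
        ≡⟨ refl⟩∘⟨ refl⟩∘⟨ refl⟩∘⟨ identityʳ _ ⟩
      (id ⊗₁ ru⇒) ∘ (id ⊗₁ (id ⊗₁ c)) ∘ (id ⊗₁ α⇒) ∘ α⇒
        ≡⟨ refl⟩∘⟨ pullˡ (sym id⊗-distrib) ⟩
      (id ⊗₁ ru⇒) ∘ (id ⊗₁ ((id ⊗₁ c) ∘ α⇒)) ∘ α⇒
        ≡⟨ pullˡ (sym id⊗-distrib) ⟩
      (id ⊗₁ bend) ∘ α⇒ ∎

module CDProperties {o ℓ : Level} {C : SymmetricMonoidalCategory o ℓ} (D : CDStructure C) where
  open SymmetricMonoidalCategory C
  open SMCNotation C
  open CDStructure D
  open SMCProperties C
  open Eq.≡-Reasoning

  -- Rescaling the identity by an effect; in a Kleisli category of measures, x ↦ e(x) δₓ.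
  weight : ∀ {A} → Hom A unit → Hom A A
  weight {A} e = ru⇒ ∘ (id ⊗₁ e) ∘ copy A

  discard∘contract : ∀ {A B Z W} (c : Hom (Z ⊗₀ W) unit) (f : Hom A (B ⊗₀ Z)) →
                     discard B ∘ contract c f ≡ c ∘ ((lu⇒ ∘ (discard B ⊗₁ id) ∘ f) ⊗₁ id)
  discard∘contract {B = B} c f = begin
    ε ∘ ru⇒ ∘ (id ⊗₁ c) ∘ α⇒ ∘ (f ⊗₁ id)
      ≡⟨ pullˡ (sym (ru-natural ε)) ⟩
    (ru⇒ ∘ (ε ⊗₁ id)) ∘ (id ⊗₁ c) ∘ α⇒ ∘ (f ⊗₁ id)
      ≡⟨ assoc _ _ _ ⟩
    ru⇒ ∘ (ε ⊗₁ id) ∘ (id ⊗₁ c) ∘ α⇒ ∘ (f ⊗₁ id)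
      ≡⟨ refl⟩∘⟨ extendˡ ⊗id-commutes-id⊗ ⟩
    ru⇒ ∘ (id ⊗₁ c) ∘ (ε ⊗₁ id) ∘ α⇒ ∘ (f ⊗₁ id)
      ≡⟨ refl⟩∘⟨ refl⟩∘⟨ (cong (ε ⊗₁_) (sym ⊗-id) ⟩∘⟨refl) ⟩
    ru⇒ ∘ (id ⊗₁ c) ∘ (ε ⊗₁ (id ⊗₁ id)) ∘ α⇒ ∘ (f ⊗₁ id)
      ≡⟨ refl⟩∘⟨ refl⟩∘⟨ extendˡ (sym (α-natural ε id id)) ⟩
    ru⇒ ∘ (id ⊗₁ c) ∘ α⇒ ∘ ((ε ⊗₁ id) ⊗₁ id) ∘ (f ⊗₁ id)
      ≡⟨ pull₃ˡ contract-unit ⟩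
    (c ∘ (lu⇒ ⊗₁ id)) ∘ ((ε ⊗₁ id) ⊗₁ id) ∘ (f ⊗₁ id)
      ≡⟨ assoc _ _ _ ⟩
    c ∘ (lu⇒ ⊗₁ id) ∘ ((ε ⊗₁ id) ⊗₁ id) ∘ (f ⊗₁ id)
      ≡⟨ refl⟩∘⟨ refl⟩∘⟨ sym ⊗id-distrib ⟩
    c ∘ (lu⇒ ⊗₁ id) ∘ (((ε ⊗₁ id) ∘ f) ⊗₁ id)
      ≡⟨ refl⟩∘⟨ sym ⊗id-distrib ⟩
    c ∘ ((lu⇒ ∘ (ε ⊗₁ id) ∘ f) ⊗₁ id) ∎
    where
    ε : Hom B unit
    ε = discard B
    contract-unit : ru⇒ ∘ (id {unit} ⊗₁ c) ∘ α⇒ ≡ c ∘ (lu⇒ ⊗₁ id)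
    contract-unit = begin
      ru⇒ ∘ (id ⊗₁ c) ∘ α⇒
        ≡⟨ sym lu⇒≡ru⇒ ⟩∘⟨refl ⟩
      lu⇒ ∘ (id ⊗₁ c) ∘ α⇒
        ≡⟨ pullˡ (lu-natural c) ⟩
      (c ∘ lu⇒) ∘ α⇒
        ≡⟨ assoc _ _ _ ⟩
      c ∘ lu⇒ ∘ α⇒
        ≡⟨ refl⟩∘⟨ lu⇒∘α⇒≡lu⇒⊗id ⟩
      c ∘ (lu⇒ ⊗₁ id) ∎

  weight-⊗ : ∀ {X Z} (w : Hom (X ⊗₀ Z) unit) →
             weight w ≡ (id ⊗₁ (lu⇒ ∘ (w ⊗₁ id) ∘ α⇐ ∘ (id ⊗₁ copy Z))) ∘ α⇒ ∘ (copy X ⊗₁ id)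
  weight-⊗ {X} {Z} w = begin
    ru⇒ ∘ (id ⊗₁ w) ∘ copy (X ⊗₀ Z)
      ≡⟨ refl⟩∘⟨ refl⟩∘⟨ copy-⊗ X Z ⟩
    ru⇒ ∘ (id ⊗₁ w) ∘ mid-swap ∘ (copy X ⊗₁ copy Z)
      ≡⟨ refl⟩∘⟨ refl⟩∘⟨ assoc₃ ⟩
    ru⇒ ∘ (id ⊗₁ w) ∘ α⇐ ∘ (id ⊗₁ P) ∘ α⇒ ∘ (copy X ⊗₁ copy Z)
      ≡⟨ refl⟩∘⟨ refl⟩∘⟨ refl⟩∘⟨ refl⟩∘⟨ refl⟩∘⟨ trans serialize₂₁ (cong (_⊗₁ copy Z) (sym ⊗-id) ⟩∘⟨refl) ⟩
    ru⇒ ∘ (id ⊗₁ w) ∘ α⇐ ∘ (id ⊗₁ P) ∘ α⇒ ∘ ((id ⊗₁ id) ⊗₁ copy Z) ∘ (copy X ⊗₁ id)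
      ≡⟨ refl⟩∘⟨ refl⟩∘⟨ refl⟩∘⟨ refl⟩∘⟨ extendˡ (α-natural id id (copy Z)) ⟩
    ru⇒ ∘ (id ⊗₁ w) ∘ α⇐ ∘ (id ⊗₁ P) ∘ (id ⊗₁ (id ⊗₁ copy Z)) ∘ α⇒ ∘ (copy X ⊗₁ id)
      ≡⟨ refl⟩∘⟨ refl⟩∘⟨ refl⟩∘⟨ pullˡ (sym id⊗-distrib) ⟩
    ru⇒ ∘ (id ⊗₁ w) ∘ α⇐ ∘ (id ⊗₁ (P ∘ (id ⊗₁ copy Z))) ∘ α⇒ ∘ (copy X ⊗₁ id)
      ≡⟨ pull₃ˡ unweight-left ⟩
    ((id ⊗₁ ru⇒) ∘ (id ⊗₁ (id ⊗₁ w))) ∘ (id ⊗₁ (P ∘ (id ⊗₁ copy Z))) ∘ α⇒ ∘ (copy X ⊗₁ id)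
      ≡⟨ trans (assoc _ _ _) (refl⟩∘⟨ pullˡ (sym id⊗-distrib)) ⟩
    (id ⊗₁ ru⇒) ∘ (id ⊗₁ ((id ⊗₁ w) ∘ P ∘ (id ⊗₁ copy Z))) ∘ α⇒ ∘ (copy X ⊗₁ id)
      ≡⟨ pullˡ (sym id⊗-distrib) ⟩
    (id ⊗₁ (ru⇒ ∘ (id ⊗₁ w) ∘ P ∘ (id ⊗₁ copy Z))) ∘ α⇒ ∘ (copy X ⊗₁ id)
      ≡⟨ cong (id ⊗₁_) weight-on-Z ⟩∘⟨refl ⟩
    (id ⊗₁ (lu⇒ ∘ (w ⊗₁ id) ∘ α⇐ ∘ (id ⊗₁ copy Z))) ∘ α⇒ ∘ (copy X ⊗₁ id) ∎
    where
    P : Hom (X ⊗₀ (Z ⊗₀ Z)) (Z ⊗₀ (X ⊗₀ Z))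
    P = α⇒ ∘ (σ ⊗₁ id) ∘ α⇐

    unweight-left : ru⇒ ∘ (id {X ⊗₀ Z} ⊗₁ w) ∘ α⇐ ≡ (id ⊗₁ ru⇒) ∘ (id ⊗₁ (id ⊗₁ w))
    unweight-left = begin
      ru⇒ ∘ (id ⊗₁ w) ∘ α⇐
        ≡⟨ refl⟩∘⟨ (cong (_⊗₁ w) (sym ⊗-id) ⟩∘⟨refl) ⟩
      ru⇒ ∘ ((id ⊗₁ id) ⊗₁ w) ∘ α⇐
        ≡⟨ refl⟩∘⟨ sym (α⇐-natural id id w) ⟩
      ru⇒ ∘ α⇐ ∘ (id ⊗₁ (id ⊗₁ w))
        ≡⟨ pullˡ ru⇒∘α⇐≡id⊗ru⇒ ⟩
      (id ⊗₁ ru⇒) ∘ (id ⊗₁ (id ⊗₁ w)) ∎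

    -- Cocommutativity of copy lets the mid-swap be traded for a plain symmetry.
    weight-on-Z : ru⇒ ∘ (id ⊗₁ w) ∘ P ∘ (id ⊗₁ copy Z) ≡ lu⇒ ∘ (w ⊗₁ id) ∘ α⇐ ∘ (id ⊗₁ copy Z)
    weight-on-Z = begin
      ru⇒ ∘ (id ⊗₁ w) ∘ P ∘ (id ⊗₁ copy Z)
        ≡⟨ refl⟩∘⟨ refl⟩∘⟨ refl⟩∘⟨ cong (id ⊗₁_) (sym (copy-comm Z)) ⟩
      ru⇒ ∘ (id ⊗₁ w) ∘ P ∘ (id ⊗₁ (σ ∘ copy Z))
        ≡⟨ refl⟩∘⟨ refl⟩∘⟨ refl⟩∘⟨ id⊗-distrib ⟩
      ru⇒ ∘ (id ⊗₁ w) ∘ P ∘ (id ⊗₁ σ) ∘ (id ⊗₁ copy Z)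
        ≡⟨ refl⟩∘⟨ refl⟩∘⟨ pullˡ α⇒∘σ⊗id∘α⇐∘id⊗σ≡σ∘α⇐ ⟩
      ru⇒ ∘ (id ⊗₁ w) ∘ (σ ∘ α⇐) ∘ (id ⊗₁ copy Z)
        ≡⟨ refl⟩∘⟨ refl⟩∘⟨ assoc _ _ _ ⟩
      ru⇒ ∘ (id ⊗₁ w) ∘ σ ∘ α⇐ ∘ (id ⊗₁ copy Z)
        ≡⟨ refl⟩∘⟨ extendˡ (sym (σ-natural w id)) ⟩
      ru⇒ ∘ σ ∘ (w ⊗₁ id) ∘ α⇐ ∘ (id ⊗₁ copy Z)
        ≡⟨ pullˡ ru⇒∘σ≡lu⇒ ⟩
      lu⇒ ∘ (w ⊗₁ id) ∘ α⇐ ∘ (id ⊗₁ copy Z) ∎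

module ECProperties {o ℓ : Level} {C : SymmetricMonoidalCategory o ℓ} {D : CDStructure C}
                    (E : EffectConditioning D) where
  open SymmetricMonoidalCategory C
  open CDStructure D
  open EffectConditioning E
  open SMCProperties C
  open CDProperties D
  open Eq.≡-Reasoning

  norm∘weight : ∀ {X Y} (f : Hom X Y) → f ≡ norm f ∘ weight (discard Y ∘ f)
  norm∘weight {X} {Y} f = begin
    f
      ≡⟨ norm-factor f ⟩
    ru⇒ ∘ (norm f ⊗₁ e) ∘ copy X
      ≡⟨ refl⟩∘⟨ (serialize₁₂ ⟩∘⟨refl) ⟩
    ru⇒ ∘ ((norm f ⊗₁ id) ∘ (id ⊗₁ e)) ∘ copy X
      ≡⟨ refl⟩∘⟨ assoc _ _ _ ⟩
    ru⇒ ∘ (norm f ⊗₁ id) ∘ (id ⊗₁ e) ∘ copy X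
      ≡⟨ pullˡ (ru-natural (norm f)) ⟩
    (norm f ∘ ru⇒) ∘ (id ⊗₁ e) ∘ copy X
      ≡⟨ assoc _ _ _ ⟩
    norm f ∘ weight e ∎
    where
    e : Hom X unit
    e = discard Y ∘ f

  cap-slide-∘ : ∀ {X Z} (m : Hom X Z) →
                lu⇒ ∘ ((cap Z ∘ (m ⊗₁ id)) ⊗₁ id) ∘ α⇐ ∘ (id ⊗₁ copy Z) ≡ contract (cap Z) (copy Z ∘ m)
  cap-slide-∘ {Z = Z} m = begin
    lu⇒ ∘ ((c ∘ (m ⊗₁ id)) ⊗₁ id) ∘ α⇐ ∘ (id ⊗₁ copy Z)
      ≡⟨ refl⟩∘⟨ trans (⊗id-distrib ⟩∘⟨refl) (assoc _ _ _) ⟩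
    lu⇒ ∘ (c ⊗₁ id) ∘ ((m ⊗₁ id) ⊗₁ id) ∘ α⇐ ∘ (id ⊗₁ copy Z)
      ≡⟨ refl⟩∘⟨ refl⟩∘⟨ extendˡ (sym (α⇐-natural m id id)) ⟩
    lu⇒ ∘ (c ⊗₁ id) ∘ α⇐ ∘ (m ⊗₁ (id ⊗₁ id)) ∘ (id ⊗₁ copy Z)
      ≡⟨ refl⟩∘⟨ refl⟩∘⟨ refl⟩∘⟨ trans (cong (m ⊗₁_) ⊗-id ⟩∘⟨refl) ⊗id-commutes-id⊗ ⟩
    lu⇒ ∘ (c ⊗₁ id) ∘ α⇐ ∘ (id ⊗₁ copy Z) ∘ (m ⊗₁ id)
      ≡⟨ pull₄ˡ (cap-slide Z) ⟩
    (ru⇒ ∘ (id ⊗₁ c) ∘ α⇒ ∘ (copy Z ⊗₁ id)) ∘ (m ⊗₁ id)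
      ≡⟨ trans (assoc _ _ _) (refl⟩∘⟨ assoc₃) ⟩
    ru⇒ ∘ (id ⊗₁ c) ∘ α⇒ ∘ (copy Z ⊗₁ id) ∘ (m ⊗₁ id)
      ≡⟨ refl⟩∘⟨ refl⟩∘⟨ refl⟩∘⟨ sym ⊗id-distrib ⟩
    ru⇒ ∘ (id ⊗₁ c) ∘ α⇒ ∘ ((copy Z ∘ m) ⊗₁ id) ∎
    where
    c : Hom (Z ⊗₀ Z) unit
    c = cap Z

  contract-cap-graph : ∀ {X Z} (m : Hom X Z) →
                       contract (cap Z) (α⇐ ∘ (id ⊗₁ copy Z) ∘ (id ⊗₁ m) ∘ copy X) ≡ weight (cap Z ∘ (m ⊗₁ id))
  contract-cap-graph {X} {Z} m = begin
    contract (cap Z) (α⇐ ∘ (id ⊗₁ copy Z) ∘ (id ⊗₁ m) ∘ copy X)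
      ≡⟨ cong (λ g → contract (cap Z) (α⇐ ∘ g)) (pullˡ (sym id⊗-distrib)) ⟩
    contract (cap Z) (α⇐ ∘ (id ⊗₁ (copy Z ∘ m)) ∘ copy X)
      ≡⟨ contract-α⇐ (cap Z) (copy Z ∘ m) (copy X) ⟩
    (id ⊗₁ contract (cap Z) (copy Z ∘ m)) ∘ α⇒ ∘ (copy X ⊗₁ id)
      ≡⟨ cong (id ⊗₁_) (sym (cap-slide-∘ m)) ⟩∘⟨refl ⟩
    (id ⊗₁ (lu⇒ ∘ ((cap Z ∘ (m ⊗₁ id)) ⊗₁ id) ∘ α⇐ ∘ (id ⊗₁ copy Z))) ∘ α⇒ ∘ (copy X ⊗₁ id)
      ≡⟨ sym (weight-⊗ (cap Z ∘ (m ⊗₁ id))) ⟩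
    weight (cap Z ∘ (m ⊗₁ id)) ∎

propositionC1 : ∀ {o ℓ : Level} (C : SymmetricMonoidalCategory o ℓ) (D : CDStructure C) (E : EffectConditioning D) →
    let open SymmetricMonoidalCategory C
        open CDStructure D
        open ECNotation E
    in ∀ {X Y Z} (f : Hom X (Y ⊗₀ Z)) →
       f ≡ (conditional f ⊗₁ id {Z}) ∘ α⇐ ∘ (id {X} ⊗₁ copy Z) ∘ (id {X} ⊗₁ marginal f) ∘ copy X
propositionC1 C D E {X} {Y} {Z} f = cap-cancel f ((conditional f ⊗₁ id) ∘ graph) (begin
  contract (cap Z) f
    ≡⟨ norm∘weight (contract (cap Z) f) ⟩
  conditional f ∘ weight (discard Y ∘ contract (cap Z) f)
    ≡⟨ refl⟩∘⟨ cong weight (discard∘contract (cap Z) f) ⟩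
  conditional f ∘ weight (cap Z ∘ (marginal f ⊗₁ id))
    ≡⟨ refl⟩∘⟨ sym (contract-cap-graph (marginal f)) ⟩
  conditional f ∘ contract (cap Z) graph
    ≡⟨ sym (contract-⊗id∘ (cap Z) (conditional f) graph) ⟩
  contract (cap Z) ((conditional f ⊗₁ id) ∘ graph) ∎)
  where
  open SymmetricMonoidalCategory C
  open CDStructure D
  open EffectConditioning E
  open ECNotation E
  open SMCProperties C
  open CDProperties D
  open ECProperties E
  open Eq.≡-Reasoning
  graph : Hom X ((X ⊗₀ Z) ⊗₀ Z)
  graph = α⇐ ∘ (id ⊗₁ copy Z) ∘ (id ⊗₁ marginal f) ∘ copy X
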